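{- Let $\mathcal M=(M,<,+,0,\ldots)$ be a DCULOAS structure. Let $s>0$ and let $f:]0,s[\rightarrow M^n$ be a bounded definable map. Then there exists a unique point $x\in M^n$ such that $\forall\varepsilon>0\,\exists\delta>0\,\forall t\,(0<t<\delta\Rightarrow|x-f(t)|<\varepsilon)$.
   Context: "Definable" means definable in $\mathcal M$ with parameters. A DCULOAS structure is a definably complete uniformly locally o-minimal expansion of the second kind of a densely linearly ordered abelian group $(M,<,+,0)$: definably complete means every definable subset of $M$ has a supremum and infimum in $M\cup\{\pm\infty\}$; uniformly locally o-minimal of the second kind means that for every definable $X\subseteq M^{n+1}$, $a\in M$, $b\in M^n$ there are an open interval $I\ni a$ and an open box $B\ni b$ such that for all $y\in B$ the set $\{x: (y,x)\in X\}\cap I$ is a finite union of points and open intervals. $|x|=\max_i|x_i|$ for $x\in M^n$. -}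

module Defs where

open import Level using (0ℓ)
open import Data.Nat using (ℕ; zero; suc)
open import Data.Fin using (Fin; zero; suc)
open import Data.Product using (Σ; ∃; _×_; _,_)
open import Data.Sum using (_⊎_)
open import Data.List using (List)
open import Data.List.Relation.Unary.Any using (Any)
open import Data.Vec.Functional using (Vector; _∷_)
open import Function using (_∘_; _⇔_)
open import Relation.Nullary using (¬_)
open import Relation.Unary using (Pred)
open import Relation.Binary using (Rel; IsStrictTotalOrder; tri<; tri≈; tri>)
open import Relation.Binary.PropositionalEquality using (_≡_)
open import Algebra.Core using (Op₁; Op₂)
open import Algebra.Structures using (IsAbelianGroup)

record DOAG : Set₁ where
  infixl 6 _+_
  infix 4 _<_
  field
    M                  : Set
    _<_                : Rel M 0ℓ
    _+_                : Op₂ M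
    0#                 : M
    -_                 : Op₁ M
    isStrictTotalOrder : IsStrictTotalOrder _≡_ _<_
    isAbelianGroup     : IsAbelianGroup _≡_ _+_ 0# -_
    +-mono-<           : ∀ {x y} z → x < y → x + z < y + z
    dense              : ∀ {x y} → x < y → ∃ λ z → (x < z) × (z < y)

module Notions (G : DOAG) where
  open DOAG G
  open IsStrictTotalOrder isStrictTotalOrder using (compare)

  infix 4 _≤_
  _≤_ : Rel M 0ℓ
  x ≤ y = (x < y) ⊎ (x ≡ y)

  infixl 6 _-_
  _-_ : Op₂ M
  x - y = x + (- y)

  max : Op₂ M
  max x y with compare x y
  ... | tri< _ _ _ = y
  ... | tri≈ _ _ _ = x
  ... | tri> _ _ _ = x

  ∣_∣ : M → M
  ∣ x ∣ = max x (- x)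

  ‖_‖ : ∀ {n} → Vector M n → M
  ‖_‖ {zero}  x = 0#
  ‖_‖ {suc n} x = max ∣ x zero ∣ ‖ x ∘ suc ‖

  snoc : ∀ {n} → Vector M n → M → Vector M (suc n)
  snoc {zero}  y x _       = x
  snoc {suc n} y x zero    = y zero
  snoc {suc n} y x (suc i) = snoc (y ∘ suc) x i

  InBox : ∀ {n} → Vector M n → Vector M n → Vector M n → Set
  InBox c d y = ∀ i → (c i < y i) × (y i < d i)

  data Piece : Set where
    point    : M → Piece
    interval : M → M → Piece

  _∈Piece_ : M → Piece → Set
  x ∈Piece point p      = x ≡ p
  x ∈Piece interval c d = (c < x) × (x < d)

  FinUnionOfPointsAndIntervals : Pred M 0ℓ → Set
  FinUnionOfPointsAndIntervals S =
    Σ (List Piece) λ ps → ∀ x → S x ⇔ Any (x ∈Piece_) ps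

-- The collection of definable (with parameters) sets of an expansion of G:
-- closed under boolean operations, coordinate substitutions (permutations,
-- diagonals, cylinders), projections, containing =, <, graph of +, and all
-- singletons (parameters).

record DefStructure (G : DOAG) : Set₁ where
  open DOAG G
  field
    Def      : (n : ℕ) → Pred (Vector M n) 0ℓ → Set
    def-ext  : ∀ {n A B} → Def n A → (∀ v → A v ⇔ B v) → Def n B
    def-¬    : ∀ {n A} → Def n A → Def n (λ v → ¬ A v)
    def-∩    : ∀ {n A B} → Def n A → Def n B → Def n (λ v → A v × B v)
    def-∪    : ∀ {n A B} → Def n A → Def n B → Def n (λ v → A v ⊎ B v)
    def-subst : ∀ {m n A} (σ : Fin m → Fin n) → Def m A → Def n (λ v → A (v ∘ σ))
    def-proj : ∀ {n A} → Def (suc n) A → Def n (λ v → Σ M λ x → A (x ∷ v))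
    def-eq   : Def 2 (λ v → v zero ≡ v (suc zero))
    def-lt   : Def 2 (λ v → v zero < v (suc zero))
    def-add  : Def 3 (λ v → v zero + v (suc zero) ≡ v (suc (suc zero)))
    def-pt   : ∀ a → Def 1 (λ v → v zero ≡ a)

module DefNotions (G : DOAG) (D : DefStructure G) where
  open DOAG G
  open Notions G
  open DefStructure D

  Definable₁ : Pred M 0ℓ → Set
  Definable₁ A = Def 1 (λ v → A (v zero))

  -- sup A exists in M ∪ {±∞}
  HasSup : Pred M 0ℓ → Set
  HasSup A =
      (∀ x → ¬ A x)                                                   -- sup = -∞
    ⊎ (Σ M λ s → (∀ x → A x → x ≤ s) × (∀ b → (∀ x → A x → x ≤ b) → s ≤ b))
    ⊎ (∀ b → Σ M λ x → A x × (b < x))                                 -- sup = +∞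

  HasInf : Pred M 0ℓ → Set
  HasInf A =
      (∀ x → ¬ A x)
    ⊎ (Σ M λ s → (∀ x → A x → s ≤ x) × (∀ b → (∀ x → A x → b ≤ x) → b ≤ s))
    ⊎ (∀ b → Σ M λ x → A x × (x < b))

  DefinablyComplete : Set₁
  DefinablyComplete = ∀ A → Definable₁ A → HasSup A × HasInf A

  UniformlyLocallyOMinimal₂ : Set₁
  UniformlyLocallyOMinimal₂ =
    ∀ n (X : Pred (Vector M (suc n)) 0ℓ) → Def (suc n) X →
    ∀ (a : M) (b : Vector M n) →
    Σ M λ c → Σ M λ d → (c < a) × (a < d) ×
    Σ (Vector M n) λ c' → Σ (Vector M n) λ d' → InBox c' d' b ×
    (∀ y → InBox c' d' y →
       FinUnionOfPointsAndIntervals (λ x → X (snoc y x) × (c < x) × (x < d)))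

record DCULOAS : Set₁ where
  field
    G  : DOAG
    D  : DefStructure G
  open DefNotions G D
  field
    definablyComplete : DefinablyComplete
    uloas             : UniformlyLocallyOMinimal₂
  open DOAG G public
  open Notions G public
  open DefStructure D public
  open DefNotions G D public

-- Notions used in the corollary, for a map f : ]0,s[ → M^n
-- (represented by a total function; only its values on ]0,s[ matter).

module _ (𝓜 : DCULOAS) where
  open DCULOAS 𝓜

  DefinableMapOn0s : (n : ℕ) (s : M) → (M → Vector M n) → Set
  DefinableMapOn0s n s f =
    Def (suc n) (λ v → (0# < v zero) × (v zero < s) × (∀ i → v (suc i) ≡ f (v zero) i))

  BoundedOn0s : (n : ℕ) (s : M) → (M → Vector M n) → Set
  BoundedOn0s n s f = Σ M λ R → ∀ t → 0# < t → t < s → ‖ f t ‖ ≤ R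

  IsLimitAt0 : (n : ℕ) (s : M) → (M → Vector M n) → Vector M n → Set
  IsLimitAt0 n s f x =
    ∀ ε → 0# < ε → Σ M λ δ → (0# < δ) ×
      (∀ t → 0# < t → t < s → t < δ → ‖ (λ i → x i - f t i) ‖ < ε)

-- Work coordinatewise. For a bounded definable g : ]0,s[ → M, the set E of y with
-- y < g(t) for all sufficiently small t > 0 is definable, inhabited and bounded above,
-- so by definable completeness it has a supremum L. Local o-minimality at 0 shows that
-- every definable subset of M either contains or avoids a whole interval ]0,δ[; applied
-- to {t | z < g(t)} for z slightly above L (which is not in E) this gives g(t) ≤ z
-- eventually, while elements of E slightly below L give the lower bound. So g(t) → L.
-- Uniqueness holds in any densely ordered group.
module Submission where

open import Defs
open import Level using (0ℓ)
open import Data.Nat using (ℕ; zero; suc)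
import Data.Nat as ℕ
open import Data.Fin using (Fin; zero; suc; _↑ˡ_; _↑ʳ_)
open import Data.Product using (Σ; _×_; _,_; proj₁; proj₂)
open import Data.Sum using (_⊎_; inj₁; inj₂)
open import Data.Empty using (⊥; ⊥-elim)
open import Data.List using ([]; _∷_)
open import Data.List.Relation.Unary.Any using (Any; here; there)
open import Data.Vec.Functional using (Vector) renaming (_∷_ to _∷ᵛ_; [] to []ᵛ)
open import Function using (_∘_; _⇔_; mk⇔; Equivalence)
open import Relation.Nullary using (¬_; yes; no)
open import Relation.Unary using (Pred)
open import Relation.Binary using (IsStrictTotalOrder; tri<; tri≈; tri>)
open import Relation.Binary.PropositionalEquality
  using (_≡_; refl; sym; trans; cong; subst; subst₂; _≗_; isEquivalence)
open import Algebra.Bundles using (AbelianGroup)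
open import Algebra.Structures using (IsAbelianGroup)
open import Axiom.ExcludedMiddle using (ExcludedMiddle)
open import Axiom.DoubleNegationElimination using (em⇒dne)
import Algebra.Properties.AbelianGroup as AbelianGroupProperties
import Relation.Binary.Construct.StrictToNonStrict as StrictToNonStrict

module OrderedGroupProperties (G : DOAG) where
  open DOAG G
  open Notions G
  open IsStrictTotalOrder isStrictTotalOrder public using (compare) renaming (trans to <-trans)
  open IsStrictTotalOrder isStrictTotalOrder using (irrefl; <-resp-≈; <-respʳ-≈; <-respˡ-≈)
  open IsAbelianGroup isAbelianGroup using (comm; identityˡ; identityʳ; inverseʳ)
  private
    module ≤ = StrictToNonStrict _≡_ _<_

  abelianGroup : AbelianGroup 0ℓ 0ℓ
  abelianGroup = record { isAbelianGroup = isAbelianGroup }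

  open AbelianGroupProperties abelianGroup
    using (//-rightDividesˡ; //-rightDividesʳ; ⁻¹-anti-homo‿-; ⁻¹-involutive)

  <-irrefl : ∀ {x} → ¬ (x < x)
  <-irrefl = irrefl refl

  <-≤-trans : ∀ {x y z} → x < y → y ≤ z → x < z
  <-≤-trans = ≤.<-≤-trans <-trans <-respʳ-≈

  ≤-<-trans : ∀ {x y z} → x ≤ y → y < z → x < z
  ≤-<-trans = ≤.≤-<-trans sym <-trans <-respˡ-≈

  ≤-trans : ∀ {x y z} → x ≤ y → y ≤ z → x ≤ z
  ≤-trans = ≤.trans isEquivalence <-resp-≈ <-trans

  ≮⇒≥ : ∀ {x y} → ¬ (x < y) → y ≤ x
  ≮⇒≥ {x} {y} x≮y with compare x y
  ... | tri< x<y _ _ = ⊥-elim (x≮y x<y)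
  ... | tri≈ _ x≡y _ = inj₂ (sym x≡y)
  ... | tri> _ _ y<x = inj₁ y<x

  ≤⇒≯ : ∀ {x y} → x ≤ y → ¬ (y < x)
  ≤⇒≯ x≤y y<x = <-irrefl (≤-<-trans x≤y y<x)

  positive? : ∀ x → 0# < x ⊎ x ≤ 0#
  positive? x with compare 0# x
  ... | tri< 0<x _ _ = inj₁ 0<x
  ... | tri≈ _ 0≡x _ = inj₂ (inj₂ (sym 0≡x))
  ... | tri> _ _ x<0 = inj₂ (inj₁ x<0)

  positive-lower-bound : ∀ {x y} → 0# < x → 0# < y →
    Σ M λ m → 0# < m × m ≤ x × m ≤ y
  positive-lower-bound {x} {y} 0<x 0<y with compare x y
  ... | tri< x<y _ _ = x , 0<x , inj₂ refl , inj₁ x<y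
  ... | tri≈ _ x≡y _ = x , 0<x , inj₂ refl , inj₂ x≡y
  ... | tri> _ _ y<x = y , 0<y , inj₁ y<x , inj₂ refl

  +-monoˡ-< : ∀ {x y} z → x < y → z + x < z + y
  +-monoˡ-< {x} {y} z x<y = subst₂ _<_ (comm x z) (comm y z) (+-mono-< z x<y)

  x-y<z⇒x<z+y : ∀ {x y z} → x - y < z → x < z + y
  x-y<z⇒x<z+y {x} {y} {z} p = subst (_< z + y) (//-rightDividesˡ y x) (+-mono-< y p)

  x<z+y⇒x-y<z : ∀ {x y z} → x < z + y → x - y < z
  x<z+y⇒x-y<z {x} {y} {z} p = subst (x - y <_) (//-rightDividesʳ y z) (+-mono-< (- y) p)

  x<y+z⇒x<z+y : ∀ {x y z} → x < y + z → x < z + y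
  x<y+z⇒x<z+y {x} {y} {z} = subst (x <_) (comm y z)

  x+[y-x]≡y : ∀ x y → x + (y - x) ≡ y
  x+[y-x]≡y x y = trans (comm x (y - x)) (//-rightDividesˡ x y)

  x-[x-y]≡y : ∀ x y → x - (x - y) ≡ y
  x-[x-y]≡y x y = trans (cong (x +_) (⁻¹-anti-homo‿- x y)) (x+[y-x]≡y x y)

  x<x+ε : ∀ x {ε} → 0# < ε → x < x + ε
  x<x+ε x {ε} 0<ε = subst (_< x + ε) (identityʳ x) (+-monoˡ-< x 0<ε)

  x-ε<x : ∀ x {ε} → 0# < ε → x - ε < x
  x-ε<x x 0<ε = x<z+y⇒x-y<z (x<x+ε x 0<ε)

  0<y-x : ∀ {x y} → x < y → 0# < y - x
  0<y-x {x} {y} x<y = subst (_< y - x) (inverseʳ x) (+-mono-< (- x) x<y)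

  neg-antitone : ∀ {x y} → x ≤ y → - y ≤ - x
  neg-antitone (inj₂ refl) = inj₂ refl
  neg-antitone {x} {y} (inj₁ x<y) = inj₁ (subst (- y <_) (identityˡ (- x)) (x-y<z⇒x<z+y -y--x<0))
    where
    -y--x<0 : - y - - x < 0#
    -y--x<0 = subst₂ _<_ (trans (comm x (- y)) (cong (- y +_) (sym (⁻¹-involutive x))))
                         (inverseʳ y)
                         (+-mono-< (- y) x<y)

  max-< : ∀ {x y z} → x < z → y < z → max x y < z
  max-< {x} {y} x<z y<z with compare x y
  ... | tri< _ _ _ = y<z
  ... | tri≈ _ _ _ = x<z
  ... | tri> _ _ _ = x<z

  x≤max : ∀ x y → x ≤ max x y
  x≤max x y with compare x y
  ... | tri< x<y _ _ = inj₁ x<y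
  ... | tri≈ _ _ _ = inj₂ refl
  ... | tri> _ _ _ = inj₂ refl

  y≤max : ∀ x y → y ≤ max x y
  y≤max x y with compare x y
  ... | tri< _ _ _ = inj₂ refl
  ... | tri≈ _ x≡y _ = inj₂ (sym x≡y)
  ... | tri> _ _ y<x = inj₁ y<x

  ∣x∣≤⇒bounds : ∀ {x r} → ∣ x ∣ ≤ r → - r ≤ x × x ≤ r
  ∣x∣≤⇒bounds {x} ∣x∣≤r =
    subst (- _ ≤_) (⁻¹-involutive x) (neg-antitone (≤-trans (y≤max x (- x)) ∣x∣≤r)) ,
    ≤-trans (x≤max x (- x)) ∣x∣≤r

  ∣x-y∣<ε⇔ : ∀ {x y ε} → ∣ x - y ∣ < ε ⇔ (x - ε < y × y < x + ε)
  ∣x-y∣<ε⇔ {x} {y} {ε} = mk⇔ to from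
    where
    to : ∣ x - y ∣ < ε → x - ε < y × y < x + ε
    to ∣x-y∣<ε =
      x<z+y⇒x-y<z (x<y+z⇒x<z+y (x-y<z⇒x<z+y (≤-<-trans (x≤max _ _) ∣x-y∣<ε))) ,
      x<y+z⇒x<z+y (x-y<z⇒x<z+y (subst (_< ε) (⁻¹-anti-homo‿- x y) (≤-<-trans (y≤max _ _) ∣x-y∣<ε)))
    from : x - ε < y × y < x + ε → ∣ x - y ∣ < ε
    from (x-ε<y , y<x+ε) = max-<
      (x<z+y⇒x-y<z (x<y+z⇒x<z+y (x-y<z⇒x<z+y x-ε<y)))
      (subst (_< ε) (sym (⁻¹-anti-homo‿- x y)) (x<z+y⇒x-y<z (x<y+z⇒x<z+y y<x+ε)))

  ∣v[i]∣≤‖v‖ : ∀ {n} (v : Vector M n) i → ∣ v i ∣ ≤ ‖ v ‖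
  ∣v[i]∣≤‖v‖ {suc n} v zero    = x≤max _ _
  ∣v[i]∣≤‖v‖ {suc n} v (suc i) = ≤-trans (∣v[i]∣≤‖v‖ (v ∘ suc) i) (y≤max _ _)

  ∣v[i]∣<⇒‖v‖< : ∀ {n} (v : Vector M n) {ε} → 0# < ε → (∀ i → ∣ v i ∣ < ε) → ‖ v ‖ < ε
  ∣v[i]∣<⇒‖v‖< {zero}  v 0<ε _   = 0<ε
  ∣v[i]∣<⇒‖v‖< {suc n} v 0<ε all = max-< (all zero) (∣v[i]∣<⇒‖v‖< (v ∘ suc) 0<ε (all ∘ suc))

  IsSupremum : Pred M 0ℓ → M → Set
  IsSupremum A L = (∀ x → A x → x ≤ L) × (∀ b → (∀ x → A x → x ≤ b) → L ≤ b)

  supremum-approximation : ExcludedMiddle 0ℓ → ∀ {A L ε} → IsSupremum A L → 0# < ε →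
    Σ M λ x → A x × L - ε < x
  supremum-approximation lem {A} {L} {ε} (_ , least) 0<ε
    with lem {Σ M λ x → A x × L - ε < x}
  ... | yes approximant = approximant
  ... | no none = ⊥-elim (≤⇒≯ (least (L - ε) L-ε-upper) (x-ε<x L 0<ε))
    where
    L-ε-upper : ∀ x → A x → x ≤ L - ε
    L-ε-upper x Ax = ≮⇒≥ (λ L-ε<x → none (x , Ax , L-ε<x))

module Germs (G : DOAG) (s : DOAG.M G) (0<s : DOAG._<_ G (DOAG.0# G) s) where
  open DOAG G
  open Notions G
  open OrderedGroupProperties G

  Eventually : Pred M 0ℓ → Set
  Eventually P = Σ M λ δ → 0# < δ × (∀ t → 0# < t → t < s → t < δ → P t)

  eventually-mono : ∀ {P Q : Pred M 0ℓ} → (∀ t → 0# < t → t < s → P t → Q t) →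
    Eventually P → Eventually Q
  eventually-mono P⇒Q (δ , 0<δ , P-near) =
    δ , 0<δ , λ t 0<t t<s t<δ → P⇒Q t 0<t t<s (P-near t 0<t t<s t<δ)

  eventually-below : ∀ {δ} → 0# < δ → Eventually (_< δ)
  eventually-below {δ} 0<δ = δ , 0<δ , λ _ _ _ t<δ → t<δ

  eventually-× : ∀ {P Q : Pred M 0ℓ} → Eventually P → Eventually Q →
    Eventually (λ t → P t × Q t)
  eventually-× (δ₁ , 0<δ₁ , P-near) (δ₂ , 0<δ₂ , Q-near)
    with positive-lower-bound 0<δ₁ 0<δ₂
  ... | δ , 0<δ , δ≤δ₁ , δ≤δ₂ = δ , 0<δ , λ t 0<t t<s t<δ →
    P-near t 0<t t<s (<-≤-trans t<δ δ≤δ₁) , Q-near t 0<t t<s (<-≤-trans t<δ δ≤δ₂)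

  eventually-∀ : ∀ {n} {P : Fin n → Pred M 0ℓ} → (∀ i → Eventually (P i)) →
    Eventually (λ t → ∀ i → P i t)
  eventually-∀ {zero}  _    = s , 0<s , λ _ _ _ _ ()
  eventually-∀ {suc n} near = eventually-mono
    (λ { t _ _ (P₀ , P₊) zero → P₀ ; t _ _ (P₀ , P₊) (suc i) → P₊ i })
    (eventually-× (near zero) (eventually-∀ (near ∘ suc)))

  eventually-inhabited : ∀ {P : Pred M 0ℓ} → Eventually P → Σ M P
  eventually-inhabited (δ , 0<δ , P-near) with positive-lower-bound 0<δ 0<s
  ... | m , 0<m , m≤δ , m≤s with dense 0<m
  ... | t , 0<t , t<m = t , P-near t 0<t (<-≤-trans t<m m≤s) (<-≤-trans t<m m≤δ)

  PieceGerm : Pred M 0ℓ → Set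
  PieceGerm P = Eventually P ⊎ Eventually (¬_ ∘ P)

  piece-germ : ∀ p → PieceGerm (_∈Piece p)
  piece-germ (point p) with positive? p
  ... | inj₁ 0<p = inj₂ (p , 0<p , λ t _ _ t<p t≡p → <-irrefl (subst (_< p) t≡p t<p))
  ... | inj₂ p≤0 = inj₂ (s , 0<s , λ t 0<t _ _ t≡p → ≤⇒≯ p≤0 (subst (0# <_) t≡p 0<t))
  piece-germ (interval a b) with positive? a | positive? b
  ... | inj₁ 0<a | _ = inj₂ (a , 0<a , λ t _ _ t<a (a<t , _) → <-irrefl (<-trans a<t t<a))
  ... | inj₂ a≤0 | inj₁ 0<b = inj₁ (b , 0<b , λ t 0<t _ t<b → ≤-<-trans a≤0 0<t , t<b)
  ... | inj₂ a≤0 | inj₂ b≤0 = inj₂ (s , 0<s , λ t 0<t _ _ (_ , t<b) → ≤⇒≯ b≤0 (<-trans 0<t t<b))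

  pieces-germ : ∀ ps → PieceGerm (λ t → Any (t ∈Piece_) ps)
  pieces-germ []       = inj₂ (s , 0<s , λ _ _ _ _ ())
  pieces-germ (p ∷ ps) with piece-germ p | pieces-germ ps
  ... | inj₁ in-p  | _          = inj₁ (eventually-mono (λ _ _ _ → here) in-p)
  ... | inj₂ _     | inj₁ in-ps = inj₁ (eventually-mono (λ _ _ _ → there) in-ps)
  ... | inj₂ out-p | inj₂ out-ps = inj₂ (eventually-mono
    (λ { t _ _ (∉p , _) (here ∈p) → ∉p ∈p ; t _ _ (_ , ∉ps) (there ∈ps) → ∉ps ∈ps })
    (eventually-× out-p out-ps))

  IsScalarLimitAt0 : (M → M) → M → Set
  IsScalarLimitAt0 g L = ∀ ε → 0# < ε → Eventually (λ t → ∣ L - g t ∣ < ε)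

  scalar-limits-separated : ∀ {g x y} → x < y →
    IsScalarLimitAt0 g x → IsScalarLimitAt0 g y → ⊥
  scalar-limits-separated {g} {x} {y} x<y x-lim y-lim with dense x<y
  ... | z , x<z , z<y
    with eventually-inhabited (eventually-× (x-lim (z - x) (0<y-x x<z)) (y-lim (y - z) (0<y-x z<y)))
  ... | t , near-x , near-y = <-irrefl (<-trans g<z z<g)
    where
    g<z : g t < z
    g<z = subst (g t <_) (x+[y-x]≡y x z) (proj₂ (Equivalence.to ∣x-y∣<ε⇔ near-x))
    z<g : z < g t
    z<g = subst (_< g t) (x-[x-y]≡y y z) (proj₁ (Equivalence.to ∣x-y∣<ε⇔ near-y))

  scalar-limit-unique : ∀ {g x y} → IsScalarLimitAt0 g x → IsScalarLimitAt0 g y → x ≡ y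
  scalar-limit-unique {x = x} {y} x-lim y-lim with compare x y
  ... | tri< x<y _ _ = ⊥-elim (scalar-limits-separated x<y x-lim y-lim)
  ... | tri≈ _ x≡y _ = x≡y
  ... | tri> _ _ y<x = ⊥-elim (scalar-limits-separated y<x y-lim x-lim)

module Definability (lem : ExcludedMiddle 0ℓ) {G : DOAG} (D : DefStructure G) where
  open DOAG G
  open DefStructure D

  def-var< : ∀ {n} (i j : Fin n) → Def n (λ v → v i < v j)
  def-var< i j = def-subst (i ∷ᵛ j ∷ᵛ []ᵛ) def-lt

  def-fix : ∀ {n A} → Def (suc n) A → ∀ a → Def n (λ v → A (a ∷ᵛ v))
  def-fix {n} {A} d a = def-ext (def-proj (def-∩ (def-subst (λ _ → zero) (def-pt a)) d))
    λ v → mk⇔ (λ { (_ , refl , A[a∷v]) → A[a∷v] }) (λ A[a∷v] → a , refl , A[a∷v])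

  def-var<const : ∀ {n} (i : Fin n) a → Def n (λ v → v i < a)
  def-var<const i = def-fix (def-var< (suc i) zero)

  def-const<var : ∀ {n} a (i : Fin n) → Def n (λ v → a < v i)
  def-const<var a i = def-fix (def-var< zero (suc i)) a

  def-∀ : ∀ {n A} → Def (suc n) A → Def n (λ v → ∀ x → A (x ∷ᵛ v))
  def-∀ {n} {A} d = def-ext (def-¬ (def-proj (def-¬ d))) λ v → mk⇔
    (λ no-counterexample x → em⇒dne lem (λ ¬A → no-counterexample (x , ¬A)))
    (λ all (x , ¬A) → ¬A (all x))

  def-→ : ∀ {n A B} → Def n A → Def n B → Def n (λ v → A v → B v)
  def-→ {n} {A} {B} dA dB = def-ext (def-∪ (def-¬ dA) dB) λ v → mk⇔
    (λ { (inj₁ ¬A) A → ⊥-elim (¬A A) ; (inj₂ B) _ → B })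
    (λ A⇒B → case-A A⇒B)
    where
    case-A : ∀ {v} → (A v → B v) → ¬ A v ⊎ B v
    case-A {v} A⇒B with lem {A v}
    ... | yes A = inj₂ (A⇒B A)
    ... | no ¬A = inj₁ ¬A

  -- Unlike Data.Vec.Functional._++_, this computes by recursion on k, so that
  -- (x ∷ w) ++ v is definitionally x ∷ (w ++ v); def-∃ⁿ depends on that.
  infixr 5 _++_
  _++_ : ∀ {k m} → Vector M k → Vector M m → Vector M (k ℕ.+ m)
  _++_ {zero}  w v = v
  _++_ {suc k} w v = w zero ∷ᵛ (w ∘ suc) ++ v

  ++-↑ˡ : ∀ {k m} (w : Vector M k) (v : Vector M m) i → (w ++ v) (i ↑ˡ m) ≡ w i
  ++-↑ˡ {suc k} w v zero    = refl
  ++-↑ˡ {suc k} w v (suc i) = ++-↑ˡ (w ∘ suc) v i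

  ++-↑ʳ : ∀ {k m} (w : Vector M k) (v : Vector M m) j → (w ++ v) (k ↑ʳ j) ≡ v j
  ++-↑ʳ {zero}  w v j = refl
  ++-↑ʳ {suc k} w v j = ++-↑ʳ (w ∘ suc) v j

  def-∃ⁿ : ∀ k {m A} → Def (k ℕ.+ m) A → Def m (λ v → Σ (Vector M k) λ w → A (w ++ v))
  def-∃ⁿ zero    d = def-ext d λ v → mk⇔ (λ A[v] → []ᵛ , A[v]) proj₂
  def-∃ⁿ (suc k) d = def-ext (def-∃ⁿ k (def-proj d)) λ v → mk⇔
    (λ { (w , x , A[x∷w++v]) → x ∷ᵛ w , A[x∷w++v] })
    (λ { (w , A[w++v]) → w ∘ suc , w zero , A[w++v] })

module LimitsOfDefinableMaps (lem : ExcludedMiddle 0ℓ) (𝓜 : DCULOAS)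
  {s : DCULOAS.M 𝓜} (0<s : DCULOAS._<_ 𝓜 (DCULOAS.0# 𝓜) s) where
  open DCULOAS 𝓜
  open OrderedGroupProperties G
  open Definability lem D
  open Germs G s 0<s

  definable-germ : ∀ {S} → Definable₁ S → Eventually S ⊎ Eventually (¬_ ∘ S)
  definable-germ {S} S-definable with uloas 0 _ S-definable 0# []ᵛ
  ... | c , d , c<0 , 0<d , _ , _ , _ , local with local []ᵛ (λ ())
  ... | ps , S∩]c,d[⇔ps with pieces-germ ps
  ... | inj₁ in-ps = inj₁ (eventually-mono
    (λ t _ _ ∈ps → proj₁ (Equivalence.from (S∩]c,d[⇔ps t) ∈ps)) in-ps)
  ... | inj₂ out-ps = inj₂ (eventually-mono
    (λ { t 0<t _ (∉ps , t<d) St →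
         ∉ps (Equivalence.to (S∩]c,d[⇔ps t) (St , <-trans c<0 0<t , t<d)) })
    (eventually-× out-ps (eventually-below 0<d)))

  supremum-of-bounded : ∀ {A a b} → HasSup A → A a → (∀ x → A x → x ≤ b) →
    Σ M (IsSupremum A)
  supremum-of-bounded {a = a} (inj₁ empty)            Aa _       = ⊥-elim (empty a Aa)
  supremum-of-bounded         (inj₂ (inj₁ supremum))  _  _       = supremum
  supremum-of-bounded {b = b} (inj₂ (inj₂ unbounded)) _  bounded with unbounded b
  ... | x , Ax , b<x = ⊥-elim (≤⇒≯ (bounded x Ax) b<x)

  StrictHypograph : (M → M) → Pred (Vector M 2) 0ℓ
  StrictHypograph g v = 0# < v (suc zero) × v (suc zero) < s × v zero < g (v (suc zero))

  limit-of-bounded-definable : ∀ g {a b} → Def 2 (StrictHypograph g) →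
    (∀ t → 0# < t → t < s → a ≤ g t × g t ≤ b) → Σ M (IsScalarLimitAt0 g)
  limit-of-bounded-definable g {a} {b} hypograph-definable bounds = L , L-limit
    where
    Above : M → Pred M 0ℓ
    Above y t = StrictHypograph g (y ∷ᵛ t ∷ᵛ []ᵛ)

    E : Pred M 0ℓ
    E y = Eventually (Above y)

    E-definable : Definable₁ E
    E-definable = def-proj (def-∩ (def-const<var 0# zero) (def-∀
      (def-→ (def-const<var 0# zero) (def-→ (def-var<const zero s) (def-→ (def-var< zero (suc zero))
        (def-subst (suc (suc zero) ∷ᵛ zero ∷ᵛ []ᵛ) hypograph-definable))))))

    a-s∈E : E (a - s)
    a-s∈E = s , 0<s , λ t 0<t t<s _ →
      0<t , t<s , <-≤-trans (x-ε<x a 0<s) (proj₁ (bounds t 0<t t<s))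

    E≤b : ∀ y → E y → y ≤ b
    E≤b y y∈E with eventually-inhabited y∈E
    ... | t , 0<t , t<s , y<gt = inj₁ (<-≤-trans y<gt (proj₂ (bounds t 0<t t<s)))

    L-supremum : Σ M (IsSupremum E)
    L-supremum = supremum-of-bounded (proj₁ (definablyComplete E E-definable)) a-s∈E E≤b

    L : M
    L = proj₁ L-supremum

    eventually-above : ∀ {ε} → 0# < ε → Eventually (λ t → L - ε < g t)
    eventually-above 0<ε with supremum-approximation lem (proj₂ L-supremum) 0<ε
    ... | y , y∈E , L-ε<y = eventually-mono (λ { t _ _ (_ , _ , y<gt) → <-trans L-ε<y y<gt }) y∈E

    -- z ∉ E for L < z, so by local o-minimality g ≤ z near 0.
    eventually-below-L+ε : ∀ {ε} → 0# < ε → Eventually (λ t → g t < L + ε)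
    eventually-below-L+ε 0<ε with dense (x<x+ε L 0<ε)
    ... | z , L<z , z<L+ε with definable-germ (def-fix hypograph-definable z)
    ... | inj₁ z∈E = ⊥-elim (≤⇒≯ (proj₁ (proj₂ L-supremum) z z∈E) L<z)
    ... | inj₂ z∉E = eventually-mono
      (λ t 0<t t<s ¬above → ≤-<-trans (≮⇒≥ (λ z<gt → ¬above (0<t , t<s , z<gt))) z<L+ε) z∉E

    L-limit : IsScalarLimitAt0 g L
    L-limit ε 0<ε = eventually-mono (λ _ _ _ → Equivalence.from ∣x-y∣<ε⇔)
      (eventually-× (eventually-above 0<ε) (eventually-below-L+ε 0<ε))

  coordinate-hypograph-definable : ∀ {n} (f : M → Vector M n) → DefinableMapOn0s 𝓜 n s f →
    ∀ k → Def 2 (StrictHypograph (λ t → f t k))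
  coordinate-hypograph-definable {n} f f-definable k =
    def-ext (def-∃ⁿ n (def-∩ (def-subst graph-coordinates f-definable)
                             (def-var< (n ↑ʳ zero) (k ↑ˡ 2))))
    λ v → mk⇔
      (λ (w , in-graph) → to (++-↑ʳ w v (suc zero)) (++-↑ʳ w v zero) in-graph)
      (λ below → let w = f (v (suc zero)) in
         w , from (++-↑ʳ w v (suc zero)) (++-↑ʳ w v zero) (++-↑ˡ w v) below)
    where
    graph-coordinates : Fin (suc n) → Fin (n ℕ.+ 2)
    graph-coordinates zero    = n ↑ʳ suc zero
    graph-coordinates (suc i) = i ↑ˡ 2

    to : ∀ {y t Y T} {W : Vector M n} → T ≡ t → Y ≡ y →
      (0# < T × T < s × (∀ i → W i ≡ f T i)) × Y < W k → 0# < t × t < s × y < f t k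
    to refl refl ((0<t , t<s , W≡f) , y<Wk) = 0<t , t<s , subst (_ <_) (W≡f k) y<Wk

    from : ∀ {y t Y T} {W : Vector M n} → T ≡ t → Y ≡ y → (∀ i → W i ≡ f t i) →
      0# < t × t < s × y < f t k → (0# < T × T < s × (∀ i → W i ≡ f T i)) × Y < W k
    from refl refl W≡f (0<t , t<s , y<ftk) = (0<t , t<s , W≡f) , subst (_ <_) (sym (W≡f k)) y<ftk

  isLimitAt0⇒coordinates : ∀ {n} (f : M → Vector M n) x → IsLimitAt0 𝓜 n s f x →
    ∀ i → IsScalarLimitAt0 (λ t → f t i) (x i)
  isLimitAt0⇒coordinates f x x-limit i ε 0<ε = eventually-mono
    (λ t _ _ → ≤-<-trans (∣v[i]∣≤‖v‖ (λ j → x j - f t j) i)) (x-limit ε 0<ε)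

  coordinates⇒isLimitAt0 : ∀ {n} (f : M → Vector M n) x →
    (∀ i → IsScalarLimitAt0 (λ t → f t i) (x i)) → IsLimitAt0 𝓜 n s f x
  coordinates⇒isLimitAt0 f x coordinate-limits ε 0<ε = eventually-mono
    (λ t _ _ → ∣v[i]∣<⇒‖v‖< (λ j → x j - f t j) 0<ε)
    (eventually-∀ (λ i → coordinate-limits i ε 0<ε))

corollary2p7 : ExcludedMiddle 0ℓ → (𝓜 : DCULOAS) → let open DCULOAS 𝓜 in
    (n : ℕ) (s : M) → 0# < s → (f : M → Vector M n) →
    DefinableMapOn0s 𝓜 n s f → BoundedOn0s 𝓜 n s f →
    Σ (Vector M n) λ x → IsLimitAt0 𝓜 n s f x ×
    (∀ y → IsLimitAt0 𝓜 n s f y → y ≗ x)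
corollary2p7 lem 𝓜 n s 0<s f f-definable (R , f-bounded) = x , x-limit , x-unique
  where
  open DCULOAS 𝓜
  open OrderedGroupProperties G
  open Germs G s 0<s
  open LimitsOfDefinableMaps lem 𝓜 0<s

  coordinate-limit : ∀ i → Σ M (IsScalarLimitAt0 (λ t → f t i))
  coordinate-limit i = limit-of-bounded-definable (λ t → f t i)
    (coordinate-hypograph-definable f f-definable i)
    (λ t 0<t t<s → ∣x∣≤⇒bounds (≤-trans (∣v[i]∣≤‖v‖ (f t) i) (f-bounded t 0<t t<s)))

  x : Vector M n
  x i = proj₁ (coordinate-limit i)

  x-limit : IsLimitAt0 𝓜 n s f x
  x-limit = coordinates⇒isLimitAt0 f x (proj₂ ∘ coordinate-limit)

  x-unique : ∀ y → IsLimitAt0 𝓜 n s f y → y ≗ x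
  x-unique y y-limit i =
    scalar-limit-unique (isLimitAt0⇒coordinates f y y-limit i) (proj₂ (coordinate-limit i))
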